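{- Let $n \ge 1$ and let $G_n$ be the graph with vertex set $\mathbb{Z}^n$ in which $u,v$ are adjacent iff $\|u-v\|_\infty = 1$. Let $S \subset \mathbb{Z}^n$ be a finite set. Then $$|\partial_e(S)| = \sum_{\epsilon \in \{ -1,0,1\}^n,\ \epsilon \neq 0} \left( |P_\epsilon(S)| + |\mathrm{gap}_\epsilon(S)| \right).$$
   Context: Edges are unordered pairs. For $A \subset \mathbb{Z}^n$, the edge boundary is $\partial_e(A) = \{\{x,y\} : \|x-y\|_\infty = 1,\ |A \cap \{x,y\}| = 1\}$. For nonzero $\epsilon \in \{ -1,0,1\}^n$, $P_\epsilon(S)$ is the orthogonal projection of $S$ onto the hyperplane $\epsilon^\perp$, i.e. $P_\epsilon(S) = \{u - \frac{\langle u,\epsilon\rangle}{\|\epsilon\|_2^2}\epsilon : u \in S\}$, where $\langle\cdot,\cdot\rangle$ is the standard inner product. Also $\mathrm{gap}_\epsilon(S) = \{x \in \mathbb{Z}^n : x - \epsilon \in S,\ x \notin S,\ \text{and } x + b\epsilon \in S \text{ for some integer } b \ge 1\}$. -}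

module Defs where

open import Data.Nat as ℕ using (ℕ; zero; suc; _⊔_; _≤_)
open import Data.Integer as ℤ using (ℤ; +_; -[1+_]; ∣_∣)
open import Data.Rational as ℚ using (ℚ)
open import Data.Vec as Vec using (Vec; []; _∷_; zipWith; foldr; map)
open import Data.List as List using (List; concatMap; filterᵇ; length)
open import Data.List.Membership.Propositional using (_∈_)
open import Data.List.Relation.Unary.AllPairs using (AllPairs)
open import Data.Bool using (Bool; true; false; not; _∧_)
open import Data.Product using (Σ; ∃; _×_; _,_; swap)
open import Data.Sum using (_⊎_)
open import Relation.Binary.PropositionalEquality using (_≡_)
open import Relation.Nullary using (¬_)

Pt : ℕ → Set
Pt n = Vec ℤ n

_⊕_ : ∀ {n} → Pt n → Pt n → Pt n
_⊕_ = zipWith ℤ._+_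

_⊖_ : ∀ {n} → Pt n → Pt n → Pt n
_⊖_ = zipWith ℤ._-_

_·_ : ∀ {n} → ℤ → Pt n → Pt n
b · v = map (b ℤ.*_) v

⟪_,_⟫ : ∀ {n} → Pt n → Pt n → ℤ
⟪ u , v ⟫ = foldr _ ℤ._+_ (+ 0) (zipWith ℤ._*_ u v)

‖_‖∞ : ∀ {n} → Pt n → ℕ
‖ v ‖∞ = foldr _ _⊔_ 0 (map ∣_∣ v)

Adj : ∀ {n} → Pt n → Pt n → Set
Adj x y = ‖ x ⊖ y ‖∞ ≡ 1

-- a finite set S ⊂ ℤⁿ is given by a list enumerating it; membership is list membership
FinSet : ℕ → Set
FinSet n = List (Pt n)

-- edge boundary: an edge is represented by an ordered pair (x , y);
-- {x,y} ∈ ∂_e(S) iff ‖x-y‖∞ = 1 and exactly one of x, y lies in S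
InBoundary : ∀ {n} → FinSet n → Pt n × Pt n → Set
InBoundary S (x , y) = Adj x y × ((x ∈ S × ¬ (y ∈ S)) ⊎ (¬ (x ∈ S) × y ∈ S))

SameEdge : ∀ {n} → Pt n × Pt n → Pt n × Pt n → Set
SameEdge e f = e ≡ f ⊎ swap e ≡ f

normSq : ∀ {n} → Pt n → ℕ
normSq ε = ∣ ⟪ ε , ε ⟫ ∣

ι : ℤ → ℚ
ι z = z ℚ./ 1

-- orthogonal projection onto ε^⊥ : u ↦ u - (⟨u,ε⟩ / ‖ε‖₂²) ε
-- (for ε = 0, which never occurs in the theorem, it is the identity)
proj : ∀ {n} → Pt n → Pt n → Vec ℚ n
proj ε u with normSq ε
... | zero = map ι u
... | suc m = zipWith (λ ui εi → ι ui ℚ.- ((⟪ u , ε ⟫ ℚ./ suc m) ℚ.* ι εi)) u ε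

InProj : ∀ {n} → Pt n → FinSet n → Vec ℚ n → Set
InProj ε S p = Σ (Pt _) λ u → u ∈ S × proj ε u ≡ p

InGap : ∀ {n} → Pt n → FinSet n → Pt n → Set
InGap ε S x = (x ⊖ ε) ∈ S × ¬ (x ∈ S) × Σ ℕ λ b → 1 ≤ b × (x ⊕ ((+ b) · ε)) ∈ S

-- HasCard _≈_ P k : the set {a | P a}, with elements identified up to _≈_,
-- has exactly k elements (witnessed by a duplicate-free exhaustive list)
HasCard : {A : Set} → (A → A → Set) → (A → Set) → ℕ → Set
HasCard {A} _≈_ P k =
  Σ (List A) λ l →
    ((a : A) → a ∈ l → P a) ×
    ((a : A) → P a → Σ A λ b → b ∈ l × a ≈ b) ×
    AllPairs (λ a b → ¬ (a ≈ b)) l ×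
    length l ≡ k

signVecs : (n : ℕ) → List (Pt n)
signVecs zero = [] List.∷ List.[]
signVecs (suc n) = concatMap (λ v → (-[1+ 0 ] ∷ v) List.∷ (+ 0 ∷ v) List.∷ (+ 1 ∷ v) List.∷ List.[]) (signVecs n)

isZeroVec : ∀ {n} → Pt n → Bool
isZeroVec [] = true
isZeroVec (+ zero ∷ v) = isZeroVec v
isZeroVec (+ suc _ ∷ v) = false
isZeroVec (-[1+ _ ] ∷ v) = false

nonzeroSigns : (n : ℕ) → List (Pt n)
nonzeroSigns n = filterᵇ (λ v → not (isZeroVec v)) (signVecs n)

module Submission where

-- Orient each boundary edge from its endpoint a ∈ S to its endpoint a + ε ∉ S, where ε ∈ {-1,0,1}ⁿ
-- is nonzero; thus |∂S| = Σ_ε #{a ∈ S : a + ε ∉ S}. Fix ε and sort these exits a by whether S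
-- still meets the ray a + bε, b ≥ 2. If not, a is the last point of S on its line parallel to ε;
-- these lines are the fibres of P_ε, so such exits are counted by |P_ε(S)|. If so, a + ε is a gap
-- point, and a ↦ a + ε is a bijection onto gap_ε(S).

open import Defs
open import Data.Nat using (ℕ; _≤_; _+_)
open import Data.Integer using (ℤ)
open import Data.Rational using (ℚ)
open import Data.Vec using (Vec)
open import Data.List using (List; map)
open import Data.Nat.ListAction using (sum)
open import Data.List.Membership.Propositional using (_∈_)
open import Data.Product using (Σ; _×_)
open import Relation.Binary.PropositionalEquality using (_≡_)

open import Data.Bool using (true; false; not; T)
open import Data.Bool.Properties using (T?)
open import Data.Empty using (⊥-elim)
open import Data.Fin using (Fin; zero; suc)
open import Data.Integer as ℤ using (+_; -[1+_]; ∣_∣)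
import Data.Integer.Properties as ℤP
open import Data.Integer.Tactic.RingSolver using (solve-∀)
open import Data.List as List using ([]; _∷_; concatMap; filter; length; deduplicate)
open import Data.List.Extrema.Nat using (max; xs≤max)
open import Data.List.Membership.Propositional using (_∉_; find; lose)
open import Data.List.Membership.Propositional.Properties
  using (∈-concatMap⁺; ∈-concatMap⁻; ∈-filter⁺; ∈-filter⁻; ∈-map⁺; ∈-map⁻; ∈-deduplicate⁺; ∈-deduplicate⁻)
import Data.List.Membership.DecPropositional as DecMembership
import Data.List.Properties as List
open import Data.List.Relation.Unary.All as All using (All)
open import Data.List.Relation.Unary.AllPairs as AllPairs using (AllPairs)
import Data.List.Relation.Unary.AllPairs.Properties as AllPairs
open import Data.List.Relation.Unary.Any as Any using (here; there)
open import Data.List.Relation.Unary.Unique.Propositional using (Unique)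
import Data.List.Relation.Unary.Unique.Propositional.Properties as Unique
import Data.List.Relation.Unary.Unique.DecPropositional.Properties as UniqueDec
open import Data.Nat as ℕ using (zero; suc; _⊔_; _<_; z≤n; s≤s)
import Data.Nat.Properties as ℕP
open import Data.Product using (_,_; proj₁; proj₂)
import Data.Rational as ℚ
import Data.Rational.Properties as ℚP
open import Data.Rational.Unnormalised as ℚᵘ using (mkℚᵘ; *≡*)
import Data.Rational.Unnormalised.Properties as ℚᵘP
open import Data.Sum using (inj₁; inj₂)
open import Data.Vec as Vec using ([]; _∷_; zipWith; lookup)
import Data.Vec.Properties as Vec
open import Function using (_∘_)
open import Relation.Binary.PropositionalEquality
  using (refl; sym; trans; cong; cong₂; subst; module ≡-Reasoning)
open import Relation.Nullary using (¬_; Dec; yes; no; ¬?; contradiction)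
open import Relation.Nullary.Decidable using (map′)
open import Relation.Unary using (Decidable)

private variable n : ℕ

greatest-below : ∀ {P : ℕ → Set} → Decidable P → ∀ B → P 0 → (∀ b → P b → b ≤ B) →
                 Σ ℕ λ K → P K × (∀ b → K < b → ¬ P b)
greatest-below P? zero P0 bounded = 0 , P0 , λ b 0<b Pb → ℕP.<⇒≱ 0<b (bounded b Pb)
greatest-below P? (suc B) P0 bounded with P? (suc B)
... | yes PB = suc B , PB , λ b B<b Pb → ℕP.<⇒≱ B<b (bounded b Pb)
... | no ¬PB = greatest-below P? B P0 λ b Pb →
  ℕP.m<1+n⇒m≤n (ℕP.≤∧≢⇒< (bounded b Pb) λ { refl → ¬PB Pb })

module _ {A : Set} where

  AllPairs-weakenOn : ∀ {P : A → Set} {R R′ : A → A → Set} →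
                      (∀ {x y} → P x → P y → R x y → R′ x y) →
                      ∀ {xs} → All P xs → AllPairs R xs → AllPairs R′ xs
  AllPairs-weakenOn f All.[] AllPairs.[] = AllPairs.[]
  AllPairs-weakenOn f (px All.∷ pxs) (rx AllPairs.∷ rxs) =
    All.zipWith (λ (py , r) → f px py r) (pxs , rx) AllPairs.∷ AllPairs-weakenOn f pxs rxs

  map-unique-on : ∀ {B : Set} (f : A → B) {xs} →
                  (∀ {x y} → x ∈ xs → y ∈ xs → f x ≡ f y → x ≡ y) →
                  Unique xs → Unique (map f xs)
  map-unique-on f inj xs! = AllPairs.map⁺
    (AllPairs-weakenOn (λ x∈ y∈ x≢y fx≡fy → x≢y (inj x∈ y∈ fx≡fy)) (All.tabulate λ x∈ → x∈) xs!)

  concatMap-unique : ∀ {B : Set} (f : A → List B) (key : B → A) {xs} →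
                     (∀ {x y} → x ∈ xs → y ∈ f x → key y ≡ x) →
                     (∀ {x} → x ∈ xs → Unique (f x)) → Unique xs → Unique (concatMap f xs)
  concatMap-unique f key {[]} keyed f! xs! = AllPairs.[]
  concatMap-unique f key {x ∷ xs} keyed f! (x∉ AllPairs.∷ xs!) =
    AllPairs.++⁺ (f! (here refl))
      (concatMap-unique f key (λ y∈ → keyed (there y∈)) (λ y∈ → f! (there y∈)) xs!)
      (All.tabulate λ y∈ → All.tabulate λ z∈ → disjoint y∈ z∈)
    where
      disjoint : ∀ {y z} → y ∈ f x → z ∈ concatMap f xs → ¬ y ≡ z
      disjoint y∈ z∈ refl with find (∈-concatMap⁻ f z∈)
      ... | w , w∈ , z∈fw = All.lookup x∉ w∈ (trans (sym (keyed (here refl) y∈)) (keyed (there w∈) z∈fw))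

  length-concatMap : ∀ {B : Set} (f : A → List B) xs →
                     length (concatMap f xs) ≡ sum (map (length ∘ f) xs)
  length-concatMap f [] = refl
  length-concatMap f (x ∷ xs) =
    trans (List.length-++ (f x)) (cong (length (f x) ℕ.+_) (length-concatMap f xs))

  length-filter-split : ∀ {P : A → Set} (P? : Decidable P) xs →
                        length xs ≡ length (filter (¬? ∘ P?) xs) + length (filter P? xs)
  length-filter-split P? [] = refl
  length-filter-split P? (x ∷ xs) with P? x
  ... | yes _ = trans (cong suc (length-filter-split P? xs)) (sym (ℕP.+-suc _ _))
  ... | no _ = cong suc (length-filter-split P? xs)

HasCard-image : ∀ {A B : Set} {P : B → Set} (f : A → B) {xs : List A} → Unique xs →
                (∀ {x y} → x ∈ xs → y ∈ xs → f x ≡ f y → x ≡ y) →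
                (∀ {x} → x ∈ xs → P (f x)) →
                (∀ {b} → P b → Σ A λ x → x ∈ xs × b ≡ f x) →
                HasCard _≡_ P (length xs)
HasCard-image {B = B} {P} f {xs} xs! inj sound complete =
  map f xs , mem , cover , map-unique-on f inj xs! , List.length-map f xs
  where
    mem : ∀ b → b ∈ map f xs → P b
    mem b b∈ with ∈-map⁻ f b∈
    ... | x , x∈ , refl = sound x∈
    cover : ∀ b → P b → Σ B λ c → c ∈ map f xs × b ≡ c
    cover b Pb with complete Pb
    ... | x , x∈ , refl = f x , ∈-map⁺ f x∈ , refl

HasCard-representatives : ∀ {A : Set} {_≈_ : A → A → Set} {P Q : A → Set} {k} →
                          (∀ {a} → Q a → P a) → (∀ {a} → P a → Σ A λ b → Q b × a ≈ b) →
                          (∀ {a b} → Q a → Q b → a ≈ b → a ≡ b) →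
                          HasCard _≡_ Q k → HasCard _≈_ P k
HasCard-representatives {A} {_≈_} {P} Q⇒P represent ≈⇒≡ (l , sound , complete , l! , len) =
  l , (λ a a∈ → Q⇒P (sound a a∈)) , cover ,
  AllPairs-weakenOn (λ Qa Qb a≢b a≈b → a≢b (≈⇒≡ Qa Qb a≈b)) (All.tabulate λ {a} a∈ → sound a a∈) l! ,
  len
  where
    cover : ∀ a → P a → Σ A λ c → c ∈ l × a ≈ c
    cover a Pa with represent Pa
    ... | b , Qb , a≈b with complete b Qb
    ...   | c , c∈ , refl = c , c∈ , a≈b


⊕-⊖-cancel : (x y : Pt n) → x ⊕ (y ⊖ x) ≡ y
⊕-⊖-cancel [] [] = refl
⊕-⊖-cancel (x ∷ xs) (y ∷ ys) = cong₂ _∷_ (identity x y) (⊕-⊖-cancel xs ys)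
  where identity : ∀ x y → x ℤ.+ (y ℤ.- x) ≡ y
        identity = solve-∀

⊕-⊖-cancelʳ : (x e : Pt n) → (x ⊕ e) ⊖ e ≡ x
⊕-⊖-cancelʳ [] [] = refl
⊕-⊖-cancelʳ (x ∷ xs) (e ∷ es) = cong₂ _∷_ (identity x e) (⊕-⊖-cancelʳ xs es)
  where identity : ∀ x e → (x ℤ.+ e) ℤ.- e ≡ x
        identity = solve-∀

⊕-⊖-cancelˡ : (x e : Pt n) → (x ⊕ e) ⊖ x ≡ e
⊕-⊖-cancelˡ [] [] = refl
⊕-⊖-cancelˡ (x ∷ xs) (e ∷ es) = cong₂ _∷_ (identity x e) (⊕-⊖-cancelˡ xs es)
  where identity : ∀ x e → (x ℤ.+ e) ℤ.- x ≡ e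
        identity = solve-∀

⊖-⊕-cancelʳ : (x e : Pt n) → (x ⊖ e) ⊕ e ≡ x
⊖-⊕-cancelʳ [] [] = refl
⊖-⊕-cancelʳ (x ∷ xs) (e ∷ es) = cong₂ _∷_ (identity x e) (⊖-⊕-cancelʳ xs es)
  where identity : ∀ x e → (x ℤ.- e) ℤ.+ e ≡ x
        identity = solve-∀

⊕-cancelˡ : (x e e′ : Pt n) → x ⊕ e ≡ x ⊕ e′ → e ≡ e′
⊕-cancelˡ x e e′ eq = trans (sym (⊕-⊖-cancelˡ x e)) (trans (cong (_⊖ x) eq) (⊕-⊖-cancelˡ x e′))

⊕-cancelʳ : (x y e : Pt n) → x ⊕ e ≡ y ⊕ e → x ≡ y
⊕-cancelʳ x y e eq = trans (sym (⊕-⊖-cancelʳ x e)) (trans (cong (_⊖ e) eq) (⊕-⊖-cancelʳ y e))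

⊕-·-+ : (u e : Pt n) (k l : ℤ) → (u ⊕ (k · e)) ⊕ (l · e) ≡ u ⊕ ((k ℤ.+ l) · e)
⊕-·-+ [] [] k l = refl
⊕-·-+ (u ∷ us) (e ∷ es) k l = cong₂ _∷_ (identity u k l e) (⊕-·-+ us es k l)
  where identity : ∀ u k l e → (u ℤ.+ k ℤ.* e) ℤ.+ l ℤ.* e ≡ u ℤ.+ (k ℤ.+ l) ℤ.* e
        identity = solve-∀

⊕-0· : (u e : Pt n) → u ⊕ ((+ 0) · e) ≡ u
⊕-0· [] [] = refl
⊕-0· (u ∷ us) (e ∷ es) = cong₂ _∷_ (ℤP.+-identityʳ u) (⊕-0· us es)

1·-identity : (e : Pt n) → (+ 1) · e ≡ e
1·-identity [] = refl
1·-identity (e ∷ es) = cong₂ _∷_ (ℤP.*-identityˡ e) (1·-identity es)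

⊕-1· : (u e : Pt n) → u ⊕ ((+ 1) · e) ≡ u ⊕ e
⊕-1· u e = cong (u ⊕_) (1·-identity e)

⊕-step : (u e : Pt n) (b : ℕ) → (u ⊕ e) ⊕ ((+ b) · e) ≡ u ⊕ ((+ suc b) · e)
⊕-step u e b = trans (cong (_⊕ ((+ b) · e)) (sym (⊕-1· u e))) (⊕-·-+ u e (+ 1) (+ b))

⊕-·-reverse : ∀ {x y : Pt n} {e} k → y ≡ x ⊕ (k · e) → x ≡ y ⊕ ((ℤ.- k) · e)
⊕-·-reverse {x = x} {e = e} k refl = begin
  x                                  ≡⟨ sym (⊕-0· x e) ⟩
  x ⊕ ((+ 0) · e)                    ≡⟨ cong (λ t → x ⊕ (t · e)) (sym (ℤP.+-inverseʳ k)) ⟩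
  x ⊕ ((k ℤ.- k) · e)                ≡⟨ sym (⊕-·-+ x e k (ℤ.- k)) ⟩
  (x ⊕ (k · e)) ⊕ ((ℤ.- k) · e)      ∎
  where open ≡-Reasoning

‖⊖‖-comm : (x y : Pt n) → ‖ x ⊖ y ‖∞ ≡ ‖ y ⊖ x ‖∞
‖⊖‖-comm [] [] = refl
‖⊖‖-comm (x ∷ xs) (y ∷ ys) = cong₂ _⊔_ (ℤP.∣i-j∣≡∣j-i∣ x y) (‖⊖‖-comm xs ys)

⟪⊕·,⟫ : (u e : Pt n) (k : ℤ) → ⟪ u ⊕ (k · e) , e ⟫ ≡ ⟪ u , e ⟫ ℤ.+ k ℤ.* ⟪ e , e ⟫
⟪⊕·,⟫ [] [] k = sym (trans (ℤP.+-identityˡ _) (ℤP.*-zeroʳ k))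
⟪⊕·,⟫ (u ∷ us) (e ∷ es) k =
  trans (cong (λ t → (u ℤ.+ k ℤ.* e) ℤ.* e ℤ.+ t) (⟪⊕·,⟫ us es k)) (identity u e k ⟪ us , es ⟫ ⟪ es , es ⟫)
  where identity : ∀ u e k a b → (u ℤ.+ k ℤ.* e) ℤ.* e ℤ.+ (a ℤ.+ k ℤ.* b) ≡
                                 (u ℤ.* e ℤ.+ a) ℤ.+ k ℤ.* (e ℤ.* e ℤ.+ b)
        identity = solve-∀

lookup-⊕· : (u e : Pt n) (k : ℤ) (j : Fin n) → lookup (u ⊕ (k · e)) j ≡ lookup u j ℤ.+ k ℤ.* lookup e j
lookup-⊕· (u ∷ us) (e ∷ es) k zero = refl
lookup-⊕· (u ∷ us) (e ∷ es) k (suc j) = lookup-⊕· us es k j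

signExtensions : Pt n → List (Pt (suc n))
signExtensions v = (-[1+ 0 ] ∷ v) ∷ (+ 0 ∷ v) ∷ (+ 1 ∷ v) ∷ []

∈-signVecs⁺ : ∀ n (d : Pt n) → ‖ d ‖∞ ≤ 1 → d ∈ signVecs n
∈-signVecs⁺ zero [] _ = here refl
∈-signVecs⁺ (suc n) (x ∷ d) ‖xd‖≤1 =
  ∈-concatMap⁺ signExtensions (lose (∈-signVecs⁺ n d (ℕP.m⊔n≤o⇒n≤o ∣ x ∣ _ ‖xd‖≤1))
                                    (extension x (ℕP.m⊔n≤o⇒m≤o ∣ x ∣ _ ‖xd‖≤1)))
  where
    extension : ∀ x → ∣ x ∣ ≤ 1 → (x ∷ d) ∈ signExtensions d
    extension -[1+ zero ] _ = here refl
    extension (+ zero) _ = there (here refl)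
    extension (+ suc zero) _ = there (there (here refl))
    extension (+ suc (suc _)) (s≤s ())
    extension -[1+ suc _ ] (s≤s ())

∈-signVecs⁻ : ∀ n (d : Pt n) → d ∈ signVecs n → ‖ d ‖∞ ≤ 1
∈-signVecs⁻ zero [] _ = z≤n
∈-signVecs⁻ (suc n) d d∈ with find (∈-concatMap⁻ signExtensions {xs = signVecs n} d∈)
... | v , v∈ , here refl = ℕP.⊔-lub ℕP.≤-refl (∈-signVecs⁻ n v v∈)
... | v , v∈ , there (here refl) = ℕP.⊔-lub z≤n (∈-signVecs⁻ n v v∈)
... | v , v∈ , there (there (here refl)) = ℕP.⊔-lub ℕP.≤-refl (∈-signVecs⁻ n v v∈)

signVecs-unique : ∀ n → Unique (signVecs n)
signVecs-unique zero = All.[] AllPairs.∷ AllPairs.[]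
signVecs-unique (suc n) =
  concatMap-unique signExtensions Vec.tail keyed (λ _ → extensions-unique) (signVecs-unique n)
  where
    keyed : ∀ {v d} → v ∈ signVecs n → d ∈ signExtensions v → Vec.tail d ≡ v
    keyed _ (here refl) = refl
    keyed _ (there (here refl)) = refl
    keyed _ (there (there (here refl))) = refl
    extensions-unique : ∀ {v : Pt n} → Unique (signExtensions v)
    extensions-unique = ((λ ()) All.∷ (λ ()) All.∷ All.[]) AllPairs.∷ ((λ ()) All.∷ All.[])
                        AllPairs.∷ All.[] AllPairs.∷ AllPairs.[]

isZeroVec⇒‖‖≡0 : (d : Pt n) → isZeroVec d ≡ true → ‖ d ‖∞ ≡ 0
isZeroVec⇒‖‖≡0 [] _ = refl
isZeroVec⇒‖‖≡0 (+ zero ∷ d) zero? = isZeroVec⇒‖‖≡0 d zero?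

¬isZeroVec⇒‖‖≥1 : (d : Pt n) → isZeroVec d ≡ false → 1 ≤ ‖ d ‖∞
¬isZeroVec⇒‖‖≥1 (+ zero ∷ d) nonzero = ¬isZeroVec⇒‖‖≥1 d nonzero
¬isZeroVec⇒‖‖≥1 (+ suc k ∷ d) _ = ℕP.≤-trans (s≤s z≤n) (ℕP.m≤m⊔n (suc k) ‖ d ‖∞)
¬isZeroVec⇒‖‖≥1 (-[1+ k ] ∷ d) _ = ℕP.≤-trans (s≤s z≤n) (ℕP.m≤m⊔n (suc k) ‖ d ‖∞)

∈-nonzeroSigns⁺ : {d : Pt n} → ‖ d ‖∞ ≡ 1 → d ∈ nonzeroSigns n
∈-nonzeroSigns⁺ {n} {d} ‖d‖≡1 =
  ∈-filter⁺ (T? ∘ (not ∘ isZeroVec)) (∈-signVecs⁺ n d (ℕP.≤-reflexive ‖d‖≡1)) nonzero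
  where
    nonzero : T (not (isZeroVec d))
    nonzero with isZeroVec d in zero?
    ... | false = _
    ... | true = contradiction (trans (sym (isZeroVec⇒‖‖≡0 d zero?)) ‖d‖≡1) λ ()

∈-nonzeroSigns⁻ : {d : Pt n} → d ∈ nonzeroSigns n → ‖ d ‖∞ ≡ 1
∈-nonzeroSigns⁻ {n} {d} d∈ with ∈-filter⁻ (T? ∘ (not ∘ isZeroVec)) {xs = signVecs n} d∈
... | d∈signs , nonzero with isZeroVec d in zero?
...   | false = ℕP.≤-antisym (∈-signVecs⁻ n d d∈signs) (¬isZeroVec⇒‖‖≥1 d zero?)

nonzeroSigns-unique : ∀ n → Unique (nonzeroSigns n)
nonzeroSigns-unique n = Unique.filter⁺ (T? ∘ (not ∘ isZeroVec)) (signVecs-unique n)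

head≤‖‖ : ∀ x (d : Pt n) → ∣ x ∣ ≤ ‖ x ∷ d ‖∞
head≤‖‖ x d = ℕP.m≤m⊔n ∣ x ∣ ‖ d ‖∞

unit-pivot : (ε : Pt n) → ‖ ε ‖∞ ≡ 1 → Σ (Fin n) λ i → lookup ε i ℤ.* lookup ε i ≡ + 1
unit-pivot (+ zero ∷ ε) unit = let i , pivot = unit-pivot ε unit in suc i , pivot
unit-pivot (+ suc zero ∷ ε) _ = zero , refl
unit-pivot (-[1+ zero ] ∷ ε) _ = zero , refl
unit-pivot (+ suc (suc k) ∷ ε) unit with s≤s () ← subst (_ ≤_) unit (head≤‖‖ (+ suc (suc k)) ε)
unit-pivot (-[1+ suc k ] ∷ ε) unit with s≤s () ← subst (_ ≤_) unit (head≤‖‖ -[1+ suc k ] ε)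

⟪,⟫-self-nonneg : (d : Pt n) → Σ ℕ λ k → ⟪ d , d ⟫ ≡ + k
⟪,⟫-self-nonneg [] = 0 , refl
⟪,⟫-self-nonneg (x ∷ d) with square x | ⟪,⟫-self-nonneg d
  where
    square : ∀ x → Σ ℕ λ k → x ℤ.* x ≡ + k
    square (+ zero) = _ , refl
    square (+ suc _) = _ , refl
    square -[1+ _ ] = _ , refl
... | a , x²≡a | b , ⟪d,d⟫≡b = a ℕ.+ b , cong₂ ℤ._+_ x²≡a ⟪d,d⟫≡b

unit-⟪,⟫-self : (ε : Pt n) → ‖ ε ‖∞ ≡ 1 → Σ ℕ λ m → ⟪ ε , ε ⟫ ≡ + suc m
unit-⟪,⟫-self (+ zero ∷ ε) unit =
  let m , ⟪ε,ε⟫≡ = unit-⟪,⟫-self ε unit in m , trans (ℤP.+-identityˡ _) ⟪ε,ε⟫≡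
unit-⟪,⟫-self (+ suc zero ∷ ε) _ =
  let k , ⟪ε,ε⟫≡ = ⟪,⟫-self-nonneg ε in k , cong (ℤ._+_ (+ 1)) ⟪ε,ε⟫≡
unit-⟪,⟫-self (-[1+ zero ] ∷ ε) _ =
  let k , ⟪ε,ε⟫≡ = ⟪,⟫-self-nonneg ε in k , cong (ℤ._+_ (+ 1)) ⟪ε,ε⟫≡
unit-⟪,⟫-self (+ suc (suc k) ∷ ε) unit with s≤s () ← subst (_ ≤_) unit (head≤‖‖ (+ suc (suc k)) ε)
unit-⟪,⟫-self (-[1+ suc k ] ∷ ε) unit with s≤s () ← subst (_ ≤_) unit (head≤‖‖ -[1+ suc k ] ε)

projCoord : ℕ → ℤ → ℤ → ℤ → ℚ
projCoord m a z e = ι a ℚ.- ((z ℚ./ suc m) ℚ.* ι e)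

proj-unfold : ∀ m (ε u : Pt n) → normSq ε ≡ suc m →
              proj ε u ≡ zipWith (λ a e → projCoord m a ⟪ u , ε ⟫ e) u ε
proj-unfold m ε u ‖ε‖²≡ with normSq ε
proj-unfold m ε u refl | .(suc m) = refl

projCoord-≃ : ∀ m a z e → ℚ.toℚᵘ (projCoord m a z e) ℚᵘ.≃ mkℚᵘ (a ℤ.* + suc m ℤ.- z ℤ.* e) m
projCoord-≃ m a z e = begin
  ℚ.toℚᵘ (ι a ℚ.- (z ℚ./ suc m) ℚ.* ι e)
    ≈⟨ ℚP.toℚᵘ-homo-+ (ι a) _ ⟩
  ℚ.toℚᵘ (ι a) ℚᵘ.+ ℚ.toℚᵘ (ℚ.- ((z ℚ./ suc m) ℚ.* ι e))
    ≈⟨ ℚᵘP.+-cong (ℚP.toℚᵘ-fromℚᵘ (mkℚᵘ a 0)) (ℚᵘP.≃-trans (ℚP.toℚᵘ-homo‿- _) (ℚᵘP.-‿cong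
         (ℚᵘP.≃-trans (ℚP.toℚᵘ-homo-* (z ℚ./ suc m) (ι e))
           (ℚᵘP.*-cong (ℚP.toℚᵘ-fromℚᵘ (mkℚᵘ z m)) (ℚP.toℚᵘ-fromℚᵘ (mkℚᵘ e 0)))))) ⟩
  mkℚᵘ a 0 ℚᵘ.- mkℚᵘ z m ℚᵘ.* mkℚᵘ e 0
    ≈⟨ *≡* (cross-multiplied m) ⟩
  mkℚᵘ (a ℤ.* + suc m ℤ.- z ℤ.* e) m ∎
  where
    open ℚᵘP.≃-Reasoning
    identity : ∀ a z e M → (a ℤ.* M ℤ.+ ℤ.- (z ℤ.* e) ℤ.* + 1) ℤ.* M ≡ (a ℤ.* M ℤ.- z ℤ.* e) ℤ.* M
    identity = solve-∀
    cross-multiplied : ∀ m → (a ℤ.* + suc (m ℕ.* 1) ℤ.+ ℤ.- (z ℤ.* e) ℤ.* + 1) ℤ.* + suc m ≡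
                             (a ℤ.* + suc m ℤ.- z ℤ.* e) ℤ.* + suc (m ℕ.* 1 ℕ.+ 0)
    cross-multiplied m rewrite ℕP.*-identityʳ m | ℕP.+-identityʳ m = identity a z e (+ suc m)

projCoord-≡⁺ : ∀ m a z a′ z′ e → a ℤ.* + suc m ℤ.- z ℤ.* e ≡ a′ ℤ.* + suc m ℤ.- z′ ℤ.* e →
               projCoord m a z e ≡ projCoord m a′ z′ e
projCoord-≡⁺ m a z a′ z′ e eq = ℚP.toℚᵘ-injective (ℚᵘP.≃-trans (projCoord-≃ m a z e)
  (ℚᵘP.≃-trans (ℚᵘP.≃-reflexive (cong (λ t → mkℚᵘ t m) eq)) (ℚᵘP.≃-sym (projCoord-≃ m a′ z′ e))))

projCoord-≡⁻ : ∀ m a z a′ z′ e → projCoord m a z e ≡ projCoord m a′ z′ e →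
               a ℤ.* + suc m ℤ.- z ℤ.* e ≡ a′ ℤ.* + suc m ℤ.- z′ ℤ.* e
projCoord-≡⁻ m a z a′ z′ e eq
  with ℚᵘP.≃-trans (ℚᵘP.≃-sym (projCoord-≃ m a z e)) (ℚᵘP.≃-trans (ℚP.toℚᵘ-cong eq) (projCoord-≃ m a′ z′ e))
... | *≡* cross = ℤP.*-cancelʳ-≡ _ _ (+ suc m) cross

projCoords-shift : ∀ m k (u e : Pt n) z →
                   zipWith (λ a eᵢ → projCoord m a (z ℤ.+ k ℤ.* + suc m) eᵢ) (u ⊕ (k · e)) e ≡
                   zipWith (λ a eᵢ → projCoord m a z eᵢ) u e
projCoords-shift m k [] [] z = refl
projCoords-shift m k (a ∷ u) (eᵢ ∷ e) z =
  cong₂ _∷_ (projCoord-≡⁺ m (a ℤ.+ k ℤ.* eᵢ) (z ℤ.+ k ℤ.* + suc m) a z eᵢ (identity a k eᵢ z (+ suc m)))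
            (projCoords-shift m k u e z)
  where identity : ∀ a k e z M → (a ℤ.+ k ℤ.* e) ℤ.* M ℤ.- (z ℤ.+ k ℤ.* M) ℤ.* e ≡ a ℤ.* M ℤ.- z ℤ.* e
        identity = solve-∀

proj-⊕· : ∀ m (ε u : Pt n) k → ⟪ ε , ε ⟫ ≡ + suc m → proj ε (u ⊕ (k · ε)) ≡ proj ε u
proj-⊕· m ε u k ⟪ε,ε⟫≡ = begin
  proj ε (u ⊕ (k · ε))
    ≡⟨ proj-unfold m ε _ ‖ε‖²≡ ⟩
  zipWith (λ a e → projCoord m a ⟪ u ⊕ (k · ε) , ε ⟫ e) (u ⊕ (k · ε)) ε
    ≡⟨ cong (λ z → zipWith (λ a e → projCoord m a z e) (u ⊕ (k · ε)) ε)
            (trans (⟪⊕·,⟫ u ε k) (cong (λ t → ⟪ u , ε ⟫ ℤ.+ k ℤ.* t) ⟪ε,ε⟫≡)) ⟩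
  zipWith (λ a e → projCoord m a (⟪ u , ε ⟫ ℤ.+ k ℤ.* + suc m) e) (u ⊕ (k · ε)) ε
    ≡⟨ projCoords-shift m k u ε ⟪ u , ε ⟫ ⟩
  zipWith (λ a e → projCoord m a ⟪ u , ε ⟫ e) u ε
    ≡⟨ sym (proj-unfold m ε u ‖ε‖²≡) ⟩
  proj ε u ∎
  where
    open ≡-Reasoning
    ‖ε‖²≡ = cong ∣_∣ ⟪ε,ε⟫≡

-- With ε_i = ±1, the i-th coordinate of v − u times ε_i reads off the multiple of ε.
proj-≡⇒collinear : ∀ m (ε u v : Pt n) i → ⟪ ε , ε ⟫ ≡ + suc m → lookup ε i ℤ.* lookup ε i ≡ + 1 →
                   proj ε u ≡ proj ε v → v ≡ u ⊕ ((lookup ε i ℤ.* (lookup v i ℤ.- lookup u i)) · ε)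
proj-≡⇒collinear {n} m ε u v i ⟪ε,ε⟫≡ pivot eq =
  trans (sym (Vec.tabulate∘lookup v)) (trans (Vec.tabulate-cong coordinate) (Vec.tabulate∘lookup _))
  where
    open ≡-Reasoning
    M = + suc m
    D = ⟪ v , ε ⟫ ℤ.- ⟪ u , ε ⟫
    εᵢ = lookup ε i
    k = εᵢ ℤ.* (lookup v i ℤ.- lookup u i)

    coords : Pt n → Vec ℚ n
    coords w = zipWith (λ a e → projCoord m a ⟪ w , ε ⟫ e) w ε

    coords-≡ : coords u ≡ coords v
    coords-≡ = trans (sym (proj-unfold m ε u (cong ∣_∣ ⟪ε,ε⟫≡))) (trans eq (proj-unfold m ε v (cong ∣_∣ ⟪ε,ε⟫≡)))

    rearrange : ∀ a b z z′ e M → a ℤ.* M ℤ.- z ℤ.* e ≡ b ℤ.* M ℤ.- z′ ℤ.* e →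
                (b ℤ.- a) ℤ.* M ≡ (z′ ℤ.- z) ℤ.* e
    rearrange a b z z′ e M numerators≡ = begin
      (b ℤ.- a) ℤ.* M
        ≡⟨ split a b z z′ e M ⟩
      ((b ℤ.* M ℤ.- z′ ℤ.* e) ℤ.- (a ℤ.* M ℤ.- z ℤ.* e)) ℤ.+ (z′ ℤ.- z) ℤ.* e
        ≡⟨ cong (λ t → (t ℤ.- (a ℤ.* M ℤ.- z ℤ.* e)) ℤ.+ (z′ ℤ.- z) ℤ.* e) (sym numerators≡) ⟩
      ((a ℤ.* M ℤ.- z ℤ.* e) ℤ.- (a ℤ.* M ℤ.- z ℤ.* e)) ℤ.+ (z′ ℤ.- z) ℤ.* e
        ≡⟨ cancel (a ℤ.* M ℤ.- z ℤ.* e) ((z′ ℤ.- z) ℤ.* e) ⟩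
      (z′ ℤ.- z) ℤ.* e ∎
      where
        split : ∀ a b z z′ e M → (b ℤ.- a) ℤ.* M ≡
                ((b ℤ.* M ℤ.- z′ ℤ.* e) ℤ.- (a ℤ.* M ℤ.- z ℤ.* e)) ℤ.+ (z′ ℤ.- z) ℤ.* e
        split = solve-∀
        cancel : ∀ X Y → (X ℤ.- X) ℤ.+ Y ≡ Y
        cancel = solve-∀

    difference : ∀ j → (lookup v j ℤ.- lookup u j) ℤ.* M ≡ D ℤ.* lookup ε j
    difference j = rearrange uⱼ vⱼ ⟪ u , ε ⟫ ⟪ v , ε ⟫ (lookup ε j) M
                             (projCoord-≡⁻ m uⱼ ⟪ u , ε ⟫ vⱼ ⟪ v , ε ⟫ (lookup ε j) (begin
      projCoord m (lookup u j) ⟪ u , ε ⟫ (lookup ε j) ≡⟨ sym (Vec.lookup-zipWith _ j u ε) ⟩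
      lookup (coords u) j                              ≡⟨ cong (λ w → lookup w j) coords-≡ ⟩
      lookup (coords v) j                              ≡⟨ Vec.lookup-zipWith _ j v ε ⟩
      projCoord m (lookup v j) ⟪ v , ε ⟫ (lookup ε j)  ∎))
      where uⱼ = lookup u j
            vⱼ = lookup v j

    D≡kM : D ≡ k ℤ.* M
    D≡kM = begin
      D                                         ≡⟨ sym (ℤP.*-identityʳ D) ⟩
      D ℤ.* + 1                                 ≡⟨ cong (D ℤ.*_) (sym pivot) ⟩
      D ℤ.* (εᵢ ℤ.* εᵢ)                         ≡⟨ regroup D εᵢ ⟩
      εᵢ ℤ.* (D ℤ.* εᵢ)                         ≡⟨ cong (εᵢ ℤ.*_) (sym (difference i)) ⟩
      εᵢ ℤ.* ((lookup v i ℤ.- lookup u i) ℤ.* M) ≡⟨ sym (ℤP.*-assoc εᵢ _ M) ⟩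
      k ℤ.* M                                   ∎
      where regroup : ∀ D e → D ℤ.* (e ℤ.* e) ≡ e ℤ.* (D ℤ.* e)
            regroup = solve-∀

    coordinate : ∀ j → lookup v j ≡ lookup (u ⊕ (k · ε)) j
    coordinate j = begin
      lookup v j                                 ≡⟨ add-difference (lookup u j) (lookup v j) ⟩
      lookup u j ℤ.+ (lookup v j ℤ.- lookup u j) ≡⟨ cong (ℤ._+_ (lookup u j)) (ℤP.*-cancelʳ-≡ _ _ M scaled) ⟩
      lookup u j ℤ.+ k ℤ.* lookup ε j            ≡⟨ sym (lookup-⊕· u ε k j) ⟩
      lookup (u ⊕ (k · ε)) j                     ∎
      where
        add-difference : ∀ x y → y ≡ x ℤ.+ (y ℤ.- x)
        add-difference = solve-∀
        right-comm : ∀ k M e → (k ℤ.* M) ℤ.* e ≡ (k ℤ.* e) ℤ.* M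
        right-comm = solve-∀
        scaled : (lookup v j ℤ.- lookup u j) ℤ.* M ≡ (k ℤ.* lookup ε j) ℤ.* M
        scaled = trans (difference j) (trans (cong (ℤ._* lookup ε j) D≡kM) (right-comm k M (lookup ε j)))

module Boundary {n : ℕ} (S : FinSet n) where

  _≟ₚ_ : (x y : Pt n) → Dec (x ≡ y)
  _≟ₚ_ = Vec.≡-dec ℤ._≟_

  open DecMembership _≟ₚ_ using (_∈?_)

  Exits : Pt n → List (Pt n)
  Exits ε = filter (λ a → ¬? ((a ⊕ ε) ∈? S)) (deduplicate _≟ₚ_ S)

  ∈-Exits⁺ : ∀ {ε a} → a ∈ S → (a ⊕ ε) ∉ S → a ∈ Exits ε
  ∈-Exits⁺ {ε} a∈ a⊕ε∉ = ∈-filter⁺ (λ a → ¬? ((a ⊕ ε) ∈? S)) (∈-deduplicate⁺ _≟ₚ_ a∈) a⊕ε∉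

  ∈-Exits⁻ : ∀ {ε a} → a ∈ Exits ε → a ∈ S × (a ⊕ ε) ∉ S
  ∈-Exits⁻ {ε} a∈ with ∈-filter⁻ (λ a → ¬? ((a ⊕ ε) ∈? S)) {xs = deduplicate _≟ₚ_ S} a∈
  ... | a∈S′ , a⊕ε∉ = ∈-deduplicate⁻ _≟ₚ_ S a∈S′ , a⊕ε∉

  Exits-unique : ∀ ε → Unique (Exits ε)
  Exits-unique ε = Unique.filter⁺ (λ a → ¬? ((a ⊕ ε) ∈? S)) (UniqueDec.deduplicate-! _≟ₚ_ S)

  module Direction (ε : Pt n) (unit : ‖ ε ‖∞ ≡ 1) where

    i : Fin n
    i = proj₁ (unit-pivot ε unit)

    m : ℕ
    m = proj₁ (unit-⟪,⟫-self ε unit)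

    ⟪ε,ε⟫≡ : ⟪ ε , ε ⟫ ≡ + suc m
    ⟪ε,ε⟫≡ = proj₂ (unit-⟪,⟫-self ε unit)

    offset : Pt n → Pt n → ℤ
    offset x s = lookup ε i ℤ.* (lookup s i ℤ.- lookup x i)

    offset-⊕· : ∀ x z → offset x (x ⊕ (z · ε)) ≡ z
    offset-⊕· x z = begin
      lookup ε i ℤ.* (lookup (x ⊕ (z · ε)) i ℤ.- lookup x i)
        ≡⟨ cong (λ t → lookup ε i ℤ.* (t ℤ.- lookup x i)) (lookup-⊕· x ε z i) ⟩
      lookup ε i ℤ.* ((lookup x i ℤ.+ z ℤ.* lookup ε i) ℤ.- lookup x i)
        ≡⟨ identity (lookup ε i) (lookup x i) z ⟩
      z ℤ.* (lookup ε i ℤ.* lookup ε i)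
        ≡⟨ cong (z ℤ.*_) (proj₂ (unit-pivot ε unit)) ⟩
      z ℤ.* + 1
        ≡⟨ ℤP.*-identityʳ z ⟩
      z ∎
      where
        open ≡-Reasoning
        identity : ∀ e x z → e ℤ.* ((x ℤ.+ z ℤ.* e) ℤ.- x) ≡ z ℤ.* (e ℤ.* e)
        identity = solve-∀

    OnRay : Pt n → Pt n → Set
    OnRay x s = Σ ℕ λ b → 1 ≤ b × s ≡ x ⊕ ((+ b) · ε)

    onRay? : ∀ x s → Dec (OnRay x s)
    onRay? x s with offset x s in offset≡
    ... | + zero = no λ { (b , 1≤b , refl) →
                            ℕP.<⇒≢ 1≤b (sym (ℤP.+-injective (trans (sym (offset-⊕· x (+ b))) offset≡))) }
    ... | -[1+ k ] = no λ { (b , _ , refl) → contradiction (trans (sym (offset-⊕· x (+ b))) offset≡) λ () }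
    ... | + suc b with s ≟ₚ (x ⊕ ((+ suc b) · ε))
    ...   | yes on = yes (suc b , s≤s z≤n , on)
    ...   | no off = no λ { (b′ , _ , refl) →
                              off (cong (λ z → x ⊕ (z · ε)) (trans (sym (offset-⊕· x (+ b′))) offset≡)) }

    Reaches : Pt n → Set
    Reaches x = Σ ℕ λ b → 1 ≤ b × (x ⊕ ((+ b) · ε)) ∈ S

    reaches? : Decidable Reaches
    reaches? x = map′ found (λ (b , 1≤b , s∈) → lose s∈ (b , 1≤b , refl)) (Any.any? (onRay? x) S)
      where
        found : Any.Any (OnRay x) S → Reaches x
        found on with find on
        ... | s , s∈ , b , 1≤b , s≡ = b , 1≤b , subst (_∈ S) s≡ s∈

    reaches-next : ∀ {x} → (x ⊕ ε) ∈ S → Reaches x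
    reaches-next {x} x⊕ε∈ = 1 , ℕP.≤-refl , subst (_∈ S) (sym (⊕-1· x ε)) x⊕ε∈

    reaches-from-next : ∀ {x} → Reaches (x ⊕ ε) → Reaches x
    reaches-from-next {x} (b , _ , s∈) = suc b , s≤s z≤n , subst (_∈ S) (⊕-step x ε b) s∈

    reaches-past-exit : ∀ {x} → (x ⊕ ε) ∉ S → Reaches x → Reaches (x ⊕ ε)
    reaches-past-exit {x} x⊕ε∉ (suc zero , _ , s∈) = contradiction (subst (_∈ S) (⊕-1· x ε) s∈) x⊕ε∉
    reaches-past-exit {x} x⊕ε∉ (suc (suc b) , _ , s∈) =
      suc b , s≤s z≤n , subst (_∈ S) (sym (⊕-step x ε (suc b))) s∈

    -- The b with u + bε ∈ S are bounded because b = offset u (u + bε).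
    lineEnd : ∀ {u} → u ∈ S → Σ ℕ λ K → (u ⊕ ((+ K) · ε)) ∈ S × ¬ Reaches (u ⊕ ((+ K) · ε))
    lineEnd {u} u∈ with greatest-below (λ b → (u ⊕ ((+ b) · ε)) ∈? S) bound
                                       (subst (_∈ S) (sym (⊕-0· u ε)) u∈) bounded
      where
        bound : ℕ
        bound = max 0 (map (∣_∣ ∘ offset u) S)
        bounded : ∀ b → (u ⊕ ((+ b) · ε)) ∈ S → b ≤ bound
        bounded b s∈ = subst (_≤ bound) (cong ∣_∣ (offset-⊕· u (+ b)))
                             (All.lookup (xs≤max 0 (map (∣_∣ ∘ offset u) S)) (∈-map⁺ (∣_∣ ∘ offset u) s∈))
    ... | K , end∈ , beyond = K , end∈ , λ (b , 1≤b , s∈) →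
      beyond (K ℕ.+ b) (ℕP.m<m+n K 1≤b) (subst (_∈ S) (⊕-·-+ u ε (+ K) (+ b)) s∈)

    ends-collinear : ∀ {x y} k → x ∈ S → y ∈ S → ¬ Reaches x → ¬ Reaches y → y ≡ x ⊕ (k · ε) → y ≡ x
    ends-collinear {x} (+ zero) _ _ _ _ y≡ = trans y≡ (⊕-0· x ε)
    ends-collinear (+ suc b) _ y∈ ¬Rx _ y≡ = ⊥-elim (¬Rx (suc b , s≤s z≤n , subst (_∈ S) y≡ y∈))
    ends-collinear -[1+ b ] x∈ _ _ ¬Ry y≡ =
      ⊥-elim (¬Ry (suc b , s≤s z≤n , subst (_∈ S) (⊕-·-reverse -[1+ b ] y≡) x∈))

    Ends Jumps : List (Pt n)
    Ends = filter (¬? ∘ reaches?) (Exits ε)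
    Jumps = filter reaches? (Exits ε)

    Exits-split : length (Exits ε) ≡ length Ends ℕ.+ length Jumps
    Exits-split = length-filter-split reaches? (Exits ε)

    Ends-card : HasCard _≡_ (InProj ε S) (length Ends)
    Ends-card = HasCard-image (proj ε) (Unique.filter⁺ (¬? ∘ reaches?) (Exits-unique ε)) injective sound complete
      where
        ∈-Ends⁻ : ∀ {a} → a ∈ Ends → a ∈ S × ¬ Reaches a
        ∈-Ends⁻ a∈ with ∈-filter⁻ (¬? ∘ reaches?) {xs = Exits ε} a∈
        ... | a∈Exits , ¬Ra = proj₁ (∈-Exits⁻ a∈Exits) , ¬Ra
        injective : ∀ {x y} → x ∈ Ends → y ∈ Ends → proj ε x ≡ proj ε y → x ≡ y
        injective {x} {y} x∈ y∈ eq with ∈-Ends⁻ x∈ | ∈-Ends⁻ y∈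
        ... | x∈S , ¬Rx | y∈S , ¬Ry =
          sym (ends-collinear (offset x y) x∈S y∈S ¬Rx ¬Ry (proj-≡⇒collinear m ε x y i ⟪ε,ε⟫≡ (proj₂ (unit-pivot ε unit)) eq))
        sound : ∀ {a} → a ∈ Ends → InProj ε S (proj ε a)
        sound {a} a∈ = a , proj₁ (∈-Ends⁻ a∈) , refl
        complete : ∀ {p} → InProj ε S p → Σ (Pt n) λ a → a ∈ Ends × p ≡ proj ε a
        complete (u , u∈ , refl) with lineEnd u∈
        ... | K , end∈ , ¬R =
          u ⊕ ((+ K) · ε) ,
          ∈-filter⁺ (¬? ∘ reaches?) (∈-Exits⁺ end∈ (¬R ∘ reaches-next)) ¬R ,
          sym (proj-⊕· m ε u (+ K) ⟪ε,ε⟫≡)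

    Jumps-card : HasCard _≡_ (InGap ε S) (length Jumps)
    Jumps-card = HasCard-image (_⊕ ε) (Unique.filter⁺ reaches? (Exits-unique ε))
                               (λ _ _ → ⊕-cancelʳ _ _ ε) sound complete
      where
        sound : ∀ {a} → a ∈ Jumps → InGap ε S (a ⊕ ε)
        sound {a} a∈ with ∈-filter⁻ reaches? {xs = Exits ε} a∈
        ... | a∈Exits , Ra with ∈-Exits⁻ a∈Exits
        ...   | a∈S , a⊕ε∉ = subst (_∈ S) (sym (⊕-⊖-cancelʳ a ε)) a∈S , a⊕ε∉ , reaches-past-exit a⊕ε∉ Ra
        complete : ∀ {x} → InGap ε S x → Σ (Pt n) λ a → a ∈ Jumps × x ≡ a ⊕ ε
        complete {x} (x⊖ε∈ , x∉ , Rx) =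
          x ⊖ ε ,
          ∈-filter⁺ reaches? (∈-Exits⁺ x⊖ε∈ (x∉ ∘ subst (_∈ S) x≡))
                             (reaches-from-next (subst Reaches (sym x≡) Rx)) ,
          sym x≡
          where x≡ = ⊖-⊕-cancelʳ x ε

  Oriented : Pt n × Pt n → Set
  Oriented (x , y) = Adj x y × x ∈ S × y ∉ S

  exitPairs : List (Pt n × Pt n)
  exitPairs = concatMap (λ ε → map (ε ,_) (Exits ε)) (nonzeroSigns n)

  ∈-exitPairs⁺ : ∀ {ε a} → ε ∈ nonzeroSigns n → a ∈ Exits ε → (ε , a) ∈ exitPairs
  ∈-exitPairs⁺ {ε} ε∈ a∈ = ∈-concatMap⁺ (λ ε → map (ε ,_) (Exits ε)) (lose ε∈ (∈-map⁺ (ε ,_) a∈))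

  ∈-exitPairs⁻ : ∀ {ε a} → (ε , a) ∈ exitPairs → ε ∈ nonzeroSigns n × a ∈ Exits ε
  ∈-exitPairs⁻ p∈ with find (∈-concatMap⁻ (λ ε → map (ε ,_) (Exits ε)) {xs = nonzeroSigns n} p∈)
  ... | ε , ε∈ , p∈block with ∈-map⁻ (ε ,_) p∈block
  ...   | a , a∈ , refl = ε∈ , a∈

  exitPairs-unique : Unique exitPairs
  exitPairs-unique = concatMap-unique (λ ε → map (ε ,_) (Exits ε)) proj₁ keyed
    (λ {ε} _ → Unique.map⁺ (cong proj₂) (Exits-unique ε)) (nonzeroSigns-unique n)
    where
      keyed : ∀ {ε p} → ε ∈ nonzeroSigns n → p ∈ map (ε ,_) (Exits ε) → proj₁ p ≡ ε
      keyed {ε} _ p∈ with ∈-map⁻ (ε ,_) p∈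
      ... | _ , _ , refl = refl

  exitPairs-length : length exitPairs ≡ sum (map (length ∘ Exits) (nonzeroSigns n))
  exitPairs-length = trans (length-concatMap (λ ε → map (ε ,_) (Exits ε)) (nonzeroSigns n))
                           (cong sum (List.map-cong (λ ε → List.length-map (ε ,_) (Exits ε)) (nonzeroSigns n)))

  Oriented-card : HasCard _≡_ Oriented (length exitPairs)
  Oriented-card = HasCard-image (λ (ε , a) → a , a ⊕ ε) exitPairs-unique injective sound complete
    where
      injective : ∀ {p q} → p ∈ exitPairs → q ∈ exitPairs →
                  (proj₂ p , proj₂ p ⊕ proj₁ p) ≡ (proj₂ q , proj₂ q ⊕ proj₁ q) → p ≡ q
      injective {ε , a} {ε′ , a′} _ _ eq with cong proj₁ eq
      ... | refl = cong (_, a) (⊕-cancelˡ a ε ε′ (cong proj₂ eq))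
      sound : ∀ {p} → p ∈ exitPairs → Oriented (proj₂ p , proj₂ p ⊕ proj₁ p)
      sound {ε , a} p∈ with ∈-exitPairs⁻ p∈
      ... | ε∈ , a∈ with ∈-Exits⁻ a∈
      ...   | a∈S , a⊕ε∉ =
        trans (‖⊖‖-comm a (a ⊕ ε)) (trans (cong ‖_‖∞ (⊕-⊖-cancelˡ a ε)) (∈-nonzeroSigns⁻ ε∈)) , a∈S , a⊕ε∉
      complete : ∀ {e} → Oriented e → Σ (Pt n × Pt n) λ p → p ∈ exitPairs × e ≡ (proj₂ p , proj₂ p ⊕ proj₁ p)
      complete {x , y} (adj , x∈ , y∉) =
        (y ⊖ x , x) ,
        ∈-exitPairs⁺ (∈-nonzeroSigns⁺ (trans (‖⊖‖-comm y x) adj))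
                     (∈-Exits⁺ x∈ (y∉ ∘ subst (_∈ S) (⊕-⊖-cancel x y))) ,
        cong (x ,_) (sym (⊕-⊖-cancel x y))

  boundary-card : HasCard SameEdge (InBoundary S) (length exitPairs)
  boundary-card = HasCard-representatives (λ (adj , x∈ , y∉) → adj , inj₁ (x∈ , y∉)) orient same⇒≡ Oriented-card
    where
      orient : ∀ {e} → InBoundary S e → Σ (Pt n × Pt n) λ f → Oriented f × SameEdge e f
      orient {x , y} (adj , inj₁ (x∈ , y∉)) = (x , y) , (adj , x∈ , y∉) , inj₁ refl
      orient {x , y} (adj , inj₂ (x∉ , y∈)) = (y , x) , (trans (‖⊖‖-comm y x) adj , y∈ , x∉) , inj₂ refl
      same⇒≡ : ∀ {e f} → Oriented e → Oriented f → SameEdge e f → e ≡ f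
      same⇒≡ _ _ (inj₁ e≡f) = e≡f
      same⇒≡ (_ , x∈ , _) (_ , _ , x∉) (inj₂ refl) = contradiction x∈ x∉

  endCount jumpCount : Pt n → ℕ
  endCount ε with ‖ ε ‖∞ ℕ.≟ 1
  ... | yes unit = length (Direction.Ends ε unit)
  ... | no _ = 0
  jumpCount ε with ‖ ε ‖∞ ℕ.≟ 1
  ... | yes unit = length (Direction.Jumps ε unit)
  ... | no _ = 0

  direction-card : ∀ {ε} → ε ∈ nonzeroSigns n →
                   (HasCard _≡_ (InProj ε S) (endCount ε) × HasCard _≡_ (InGap ε S) (jumpCount ε)) ×
                   length (Exits ε) ≡ endCount ε ℕ.+ jumpCount ε
  direction-card {ε} ε∈ with ‖ ε ‖∞ ℕ.≟ 1
  ... | yes unit = (Ends-card , Jumps-card) , Exits-split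
    where open Direction ε unit
  ... | no ¬unit = contradiction (∈-nonzeroSigns⁻ ε∈) ¬unit

theorem1 : (n : ℕ) → 1 ≤ n → (S : FinSet n) →
    Σ ℕ λ e → HasCard SameEdge (InBoundary S) e ×
    Σ (Pt n → ℕ) λ p → Σ (Pt n → ℕ) λ g →
      ((ε : Pt n) → ε ∈ nonzeroSigns n →
        HasCard _≡_ (InProj ε S) (p ε) × HasCard _≡_ (InGap ε S) (g ε)) ×
      e ≡ sum (map (λ ε → p ε + g ε) (nonzeroSigns n))
theorem1 n _ S =
  length exitPairs , boundary-card , endCount , jumpCount ,
  (λ ε ε∈ → proj₁ (direction-card ε∈)) ,
  trans exitPairs-length (cong sum (List.map-cong-local (All.tabulate λ ε∈ → proj₂ (direction-card ε∈))))
  where open Boundary S
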